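{- For all integers $n \ge 1$ and $k \ge 0$, $$\Delta\, \mathcal{B}_{n,k}(q,y,z) = \widehat{\mathcal{B}}_{n,k}(q,y-1,z-1),$$ where $\Delta$ acts on the coefficients in $\mathcal{G}_{n,k}$ (i.e. $\Delta$ is extended $\mathbb{C}[q,y,z]$-linearly), with all objects as defined in the context.
   Context: Let $\Gamma_{n,k}$ be the set of directed graphs with vertices $1,\dots,n$ and $k$ numbered edges, i.e. sequences $G=([a_1,b_1],\dots,[a_k,b_k])$ with $a_i,b_i\in\{1,\dots,n\}$ (loops $[a,a]$ and repeated edges allowed). Let $\mathcal{G}_{n,k}$ be the complex vector space with basis $\Gamma_{n,k}$. For $G\in\Gamma_{n,k}$ the Bernardi polynomial is $B_G(q,y,z)=\sum_{f:\{1,\dots,n\}\to\{1,\dots,q\}} y^{\#f^{>}_G} z^{\#f^{<}_G}$, where $f^{>}_G$ (resp. $f^{<}_G$) is the set of edges $[a,b]$ of $G$ with $f(b)>f(a)$ (resp. $f(b)<f(a)$); this is a polynomial in $q,y,z$. For a polynomial $P\in\mathbb{C}[q,y,z]$, $[P]_k$ denotes the sum of those terms of $P$ whose monomial $q^s y^i z^j$ satisfies $i+j=k$ (any $s$). Define $$\mathcal{B}_{n,k}(q,y,z)=\sum_{G\in\Gamma_{n,k}} B_G(q,y,z)\,G,\qquad \widehat{\mathcal{B}}_{n,k}(q,y,z)=\sum_{G\in\Gamma_{n,k}} [B_G]_k(q,y,z)\,G,$$ elements of $\mathcal{G}_{n,k}[q,y,z]$. For $i\in\{1,\dots,k\}$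 and $p,r\in\{1,\dots,n\}$ let $R_{p,r;i}:\Gamma_{n,k}\to\Gamma_{n,k}$ replace the $i$-th edge of a graph by the edge $[p,r]$ (keeping number $i$). Let $B_i:\mathcal{G}_{n,k}\to\mathcal{G}_{n,k}$ be the linear operator defined on $G\in\Gamma_{n,k}$ whose $i$-th edge is $[a,b]$ by $B_i(G)=G$ if $a\neq b$, and $B_i(G)=-\sum_{m\neq a} R_{a,m;i}G$ if $a=b$ (sum over $m\in\{1,\dots,n\}\setminus\{a\}$). The Laplace operator is $\Delta=B_1B_2\cdots B_k$. -}

module Defs where

open import Data.Nat as ℕ using (ℕ; zero; suc)
open import Data.Integer as ℤ using (ℤ; _-_; 1ℤ; 0ℤ)
open import Data.Fin as Fin using (Fin)
open import Data.Fin.Properties as FinP using ()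
open import Data.Product using (_×_; _,_; proj₁; proj₂)
import Data.Product.Properties as ProdP
open import Data.Vec as Vec using (Vec; []; _∷_; lookup; _[_]≔_)
import Data.Vec.Properties as VecP
open import Data.List as List using (List; []; _∷_; map; concatMap; foldr; allFin; filterᵇ)
open import Data.Bool using (Bool; true; false; if_then_else_)
open import Relation.Nullary.Decidable using (does; ⌊_⌋)
open import Relation.Binary.Definitions using (DecidableEquality)

sumℤ : List ℤ → ℤ
sumℤ = foldr ℤ._+_ 0ℤ

-- Directed graphs with vertices Fin n (= {1..n}) and k numbered edges:
-- the i-th entry of the vector is the i-th edge [a_i , b_i].

Edge : ℕ → Set
Edge n = Fin n × Fin n

Graph : ℕ → ℕ → Set
Graph n k = Vec (Edge n) k

_≟G_ : ∀ {n k} → DecidableEquality (Graph n k)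
_≟G_ = VecP.≡-dec (ProdP.≡-dec Fin._≟_ Fin._≟_)

allVecs : ∀ {A : Set} → List A → (k : ℕ) → List (Vec A k)
allVecs xs zero    = [] ∷ []
allVecs xs (suc k) = concatMap (λ x → map (x ∷_) (allVecs xs k)) xs

-- the finite set Γ_{n,k}, enumerated (each graph exactly once)
allGraphs : (n k : ℕ) → List (Graph n k)
allGraphs n k = allVecs (List.cartesianProduct (allFin n) (allFin n)) k

-- Polynomials in y, z with integer coefficients, as finite sums of
-- monomials  c · y^i · z^j  (represented by (c , i , j)).

YZPoly : Set
YZPoly = List (ℤ × ℕ × ℕ)

evalYZ : YZPoly → ℤ → ℤ → ℤ
evalYZ p y z = sumℤ (map (λ { (c , i , j) → c ℤ.* (y ℤ.^ i) ℤ.* (z ℤ.^ j) }) p)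

trunc : ℕ → YZPoly → YZPoly
trunc k = filterᵇ (λ { (c , i , j) → ⌊ (i ℕ.+ j) ℕ.≟ k ⌋ })

-- Bernardi polynomial (for a fixed value q ∈ ℕ of the variable q):
-- B_G(q,y,z) = Σ_{f : Fin n → Fin q} y^{#f^>_G} z^{#f^<_G}.

countᵇ : ∀ {A : Set} {k} → (A → Bool) → Vec A k → ℕ
countᵇ p []       = zero
countᵇ p (x ∷ xs) = if p x then suc (countᵇ p xs) else countᵇ p xs

#up : ∀ {n k q} → Vec (Fin q) n → Graph n k → ℕ
#up f G = countᵇ (λ { (a , b) → ⌊ lookup f a Fin.<? lookup f b ⌋ }) G

#down : ∀ {n k q} → Vec (Fin q) n → Graph n k → ℕ
#down f G = countᵇ (λ { (a , b) → ⌊ lookup f b Fin.<? lookup f a ⌋ }) G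

Bernardi : ∀ {n k} → ℕ → Graph n k → YZPoly
Bernardi {n} q G = map (λ f → (1ℤ , #up f G , #down f G)) (allVecs (allFin q) n)

-- Elements of 𝒢_{n,k} (with integer coefficients) as finite formal
-- linear combinations; the coefficient of a graph H is extracted by coeff.

Lin : ℕ → ℕ → Set
Lin n k = List (ℤ × Graph n k)

coeff : ∀ {n k} → Graph n k → Lin n k → ℤ
coeff H v = sumℤ (map (λ { (c , G) → if ⌊ G ≟G H ⌋ then c else 0ℤ }) v)

Bop : ∀ {n k} → Fin k → Lin n k → Lin n k
Bop {n} i = concatMap step
  where
  step : _ → _
  step (c , G) with lookup G i
  ... | (a , b) =
    if ⌊ a Fin.≟ b ⌋
    then map (λ m → (ℤ.- c , G [ i ]≔ (a , m)))
             (filterᵇ (λ m → Data.Bool.not ⌊ m Fin.≟ a ⌋) (allFin n))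
    else (c , G) ∷ []
    where import Data.Bool

Δ : ∀ {n k} → Lin n k → Lin n k
Δ {k = k} v = foldr Bop v (allFin k)

𝓑 : (n k q : ℕ) → ℤ → ℤ → Lin n k
𝓑 n k q y z = map (λ G → (evalYZ (Bernardi q G) y z , G)) (allGraphs n k)

𝓑^ : (n k q : ℕ) → ℤ → ℤ → Lin n k
𝓑^ n k q y z = map (λ G → (evalYZ (trunc k (Bernardi q G)) y z , G)) (allGraphs n k)

-- Pair both sides with the point functional δ H: then coeff H (Δ v) = ⟨ Δᵀ (δ H) ∣ v ⟩ for the
-- transpose Δᵀ of Δ acting on functionals Graph n k → ℤ.  Since B_i only touches the i-th edge,
-- its transpose acts on product functionals G ↦ ∏ⱼ ψⱼ (G j) by the transpose βᵀ of the one-edge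
-- operator on the i-th factor, so Δᵀ (δ H) = ⨂ⱼ βᵀ (δ (H j)).  On the other side
-- B_G = Σ_f ∏_{e ∈ G} w_f(e), where w_f(e) is y, z or 1 as f ascends, descends or is level along e,
-- so pairing with a product functional factorises over the edges.  The one-edge operator maps
-- Σₑ w(e) e to Σₑ (β w)(e) e with (β w)(a , b) = w(a , b) − w(a , a); this turns the weights
-- (y, z, 1) into (y − 1, z − 1, 0), whose products are exactly the monomials of [B_G]_k(q, y−1, z−1).
module Submission where

open import Defs
open import Data.Nat using (ℕ; _≤_)
open import Data.Integer using (ℤ; _-_; 1ℤ)
open import Relation.Binary.PropositionalEquality using (_≡_)

open import Data.Nat as ℕ using (zero; suc)
import Data.Nat.Properties as ℕP
open import Data.Integer as ℤ using (0ℤ; _+_; _*_; -_; _^_)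
import Data.Integer.Properties as ℤP
open import Data.Integer.Tactic.RingSolver using (solve-∀)
open import Data.Fin as Fin using (Fin)
import Data.Fin.Properties as FinP
open import Data.Product using (_×_; _,_; proj₁; proj₂)
open import Data.Vec as Vec using (Vec; []; _∷_; lookup; _[_]≔_; _[_]%=_)
import Data.Vec.Properties as VecP
import Data.Product.Properties as ProdP
open import Relation.Binary.Definitions using (DecidableEquality)
open import Data.List as List using (List; []; _∷_; map; concatMap; foldr; foldl; allFin; filterᵇ; _++_)
import Data.List.Properties as ListP
open import Data.Bool using (Bool; true; false; if_then_else_; not; _∧_)
open import Data.Empty using (⊥-elim)
open import Function using (_∘_)
open import Relation.Nullary.Decidable using (⌊_⌋; yes; no; ⌊⌋-map′)
open import Relation.Binary.PropositionalEquality using (refl; sym; trans; cong; cong₂; _≗_; module ≡-Reasoning)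
open ≡-Reasoning

-- Finite sums and products

∑ : ∀ {A : Set} → List A → (A → ℤ) → ℤ
∑ xs g = sumℤ (map g xs)

∑-cong : ∀ {A : Set} (xs : List A) {f g : A → ℤ} → f ≗ g → ∑ xs f ≡ ∑ xs g
∑-cong xs f≗g = cong sumℤ (ListP.map-cong f≗g xs)

∑-++ : ∀ {A : Set} (xs ys : List A) (g : A → ℤ) → ∑ (xs ++ ys) g ≡ ∑ xs g + ∑ ys g
∑-++ []       ys g = sym (ℤP.+-identityˡ _)
∑-++ (x ∷ xs) ys g = trans (cong (g x +_) (∑-++ xs ys g)) (sym (ℤP.+-assoc (g x) _ _))

∑-map : ∀ {A B : Set} (f : A → B) (xs : List A) (g : B → ℤ) → ∑ (map f xs) g ≡ ∑ xs (g ∘ f)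
∑-map f xs g = cong sumℤ (sym (ListP.map-∘ xs))

∑-concatMap : ∀ {A B : Set} (f : A → List B) (xs : List A) (g : B → ℤ) →
  ∑ (concatMap f xs) g ≡ ∑ xs (λ x → ∑ (f x) g)
∑-concatMap f []       g = refl
∑-concatMap f (x ∷ xs) g = trans (∑-++ (f x) (concatMap f xs) g) (cong (∑ (f x) g +_) (∑-concatMap f xs g))

∑-cartesianProduct : ∀ {A B : Set} (xs : List A) (ys : List B) (g : A × B → ℤ) →
  ∑ (List.cartesianProduct xs ys) g ≡ ∑ xs (λ x → ∑ ys (λ y → g (x , y)))
∑-cartesianProduct []       ys g = refl
∑-cartesianProduct (x ∷ xs) ys g = begin
  ∑ (map (x ,_) ys ++ List.cartesianProduct xs ys) g
    ≡⟨ ∑-++ (map (x ,_) ys) _ g ⟩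
  ∑ (map (x ,_) ys) g + ∑ (List.cartesianProduct xs ys) g
    ≡⟨ cong₂ _+_ (∑-map (x ,_) ys g) (∑-cartesianProduct xs ys g) ⟩
  ∑ ys (λ y → g (x , y)) + ∑ xs (λ x → ∑ ys (λ y → g (x , y)))
    ∎

*-distribˡ-∑ : ∀ {A : Set} (c : ℤ) (xs : List A) (g : A → ℤ) → c * ∑ xs g ≡ ∑ xs (λ x → c * g x)
*-distribˡ-∑ c []       g = ℤP.*-zeroʳ c
*-distribˡ-∑ c (x ∷ xs) g = trans (ℤP.*-distribˡ-+ c (g x) _) (cong (c * g x +_) (*-distribˡ-∑ c xs g))

*-distribʳ-∑ : ∀ {A : Set} (c : ℤ) (xs : List A) (g : A → ℤ) → ∑ xs g * c ≡ ∑ xs (λ x → g x * c)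
*-distribʳ-∑ c xs g = trans (ℤP.*-comm _ c) (trans (*-distribˡ-∑ c xs g) (∑-cong xs (λ x → ℤP.*-comm c (g x))))

∑-distrib-+ : ∀ {A : Set} (xs : List A) (f g : A → ℤ) → ∑ xs (λ x → f x + g x) ≡ ∑ xs f + ∑ xs g
∑-distrib-+ []       f g = refl
∑-distrib-+ (x ∷ xs) f g = trans (cong (f x + g x +_) (∑-distrib-+ xs f g)) (interchange (f x) (g x) _ _)
  where
  interchange : ∀ a b c d → (a + b) + (c + d) ≡ (a + c) + (b + d)
  interchange = solve-∀

∑-neg : ∀ {A : Set} (xs : List A) (g : A → ℤ) → ∑ xs (λ x → - g x) ≡ - ∑ xs g
∑-neg []       g = refl
∑-neg (x ∷ xs) g = trans (cong (- g x +_) (∑-neg xs g)) (sym (ℤP.neg-distrib-+ (g x) _))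

∑-distrib-- : ∀ {A : Set} (xs : List A) (f g : A → ℤ) → ∑ xs (λ x → f x - g x) ≡ ∑ xs f - ∑ xs g
∑-distrib-- xs f g = trans (∑-distrib-+ xs f (λ x → - g x)) (cong (∑ xs f +_) (∑-neg xs g))

∑-0 : ∀ {A : Set} (xs : List A) → ∑ xs (λ _ → 0ℤ) ≡ 0ℤ
∑-0 []       = refl
∑-0 (x ∷ xs) = trans (ℤP.+-identityˡ _) (∑-0 xs)

∑-comm : ∀ {A B : Set} (xs : List A) (ys : List B) (g : A → B → ℤ) →
  ∑ xs (λ x → ∑ ys (g x)) ≡ ∑ ys (λ y → ∑ xs (λ x → g x y))
∑-comm []       ys g = sym (∑-0 ys)
∑-comm (x ∷ xs) ys g = trans (cong (∑ ys (g x) +_) (∑-comm xs ys g)) (sym (∑-distrib-+ ys (g x) _))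

𝟙 : Bool → ℤ
𝟙 true  = 1ℤ
𝟙 false = 0ℤ

𝟙-not : ∀ b x → 𝟙 (not b) * x ≡ x - 𝟙 b * x
𝟙-not true  = solve-∀
𝟙-not false = solve-∀

𝟙[m≟m+l]≡0^l : ∀ m l → 𝟙 ⌊ m ℕ.≟ m ℕ.+ l ⌋ ≡ 0ℤ ^ l
𝟙[m≟m+l]≡0^l m l with m ℕ.≟ m ℕ.+ l
... | yes m≡m+l = cong (0ℤ ^_) (sym (ℕP.+-cancelˡ-≡ m l 0 (trans (sym m≡m+l) (sym (ℕP.+-identityʳ m)))))
𝟙[m≟m+l]≡0^l m zero    | no m≢m+0 = ⊥-elim (m≢m+0 (sym (ℕP.+-identityʳ m)))
𝟙[m≟m+l]≡0^l m (suc l) | no _     = sym (ℤP.*-zeroˡ (0ℤ ^ l))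

∑-filterᵇ : ∀ {A : Set} (p : A → Bool) (xs : List A) (g : A → ℤ) →
  ∑ (filterᵇ p xs) g ≡ ∑ xs (λ x → 𝟙 (p x) * g x)
∑-filterᵇ p []       g = refl
∑-filterᵇ p (x ∷ xs) g with p x
... | true  = cong₂ _+_ (sym (ℤP.*-identityˡ (g x))) (∑-filterᵇ p xs g)
... | false = trans (∑-filterᵇ p xs g) (sym (trans (cong (_+ rest) (ℤP.*-zeroˡ (g x))) (ℤP.+-identityˡ rest)))
  where
  rest : ℤ
  rest = ∑ xs (λ x → 𝟙 (p x) * g x)

∑-allFin-suc : ∀ {n} (g : Fin (suc n) → ℤ) → ∑ (allFin (suc n)) g ≡ g Fin.zero + ∑ (allFin n) (g ∘ Fin.suc)
∑-allFin-suc g = cong (λ xs → g Fin.zero + sumℤ xs)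
  (trans (ListP.map-tabulate Fin.suc g) (sym (ListP.map-tabulate (λ x → x) (g ∘ Fin.suc))))

∑-allFin-≟ : ∀ {n} (a : Fin n) (g : Fin n → ℤ) → ∑ (allFin n) (λ x → 𝟙 ⌊ x Fin.≟ a ⌋ * g x) ≡ g a
∑-allFin-≟ {suc n} Fin.zero g = begin
  ∑ (allFin (suc n)) (λ x → 𝟙 ⌊ x Fin.≟ Fin.zero ⌋ * g x)
    ≡⟨ ∑-allFin-suc (λ x → 𝟙 ⌊ x Fin.≟ Fin.zero ⌋ * g x) ⟩
  1ℤ * g Fin.zero + ∑ (allFin n) (λ x → 0ℤ * g (Fin.suc x))
    ≡⟨ cong₂ _+_ (ℤP.*-identityˡ (g Fin.zero)) (∑-0 (allFin n)) ⟩
  g Fin.zero + 0ℤ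
    ≡⟨ ℤP.+-identityʳ _ ⟩
  g Fin.zero
    ∎
∑-allFin-≟ {suc n} (Fin.suc a) g = begin
  ∑ (allFin (suc n)) (λ x → 𝟙 ⌊ x Fin.≟ Fin.suc a ⌋ * g x)
    ≡⟨ ∑-allFin-suc (λ x → 𝟙 ⌊ x Fin.≟ Fin.suc a ⌋ * g x) ⟩
  0ℤ * g Fin.zero + ∑ (allFin n) (λ x → 𝟙 ⌊ Fin.suc x Fin.≟ Fin.suc a ⌋ * g (Fin.suc x))
    ≡⟨ cong₂ _+_ (ℤP.*-zeroˡ (g Fin.zero)) (∑-cong (allFin n) suc≟suc) ⟩
  0ℤ + ∑ (allFin n) (λ x → 𝟙 ⌊ x Fin.≟ a ⌋ * g (Fin.suc x))
    ≡⟨ ℤP.+-identityˡ _ ⟩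
  ∑ (allFin n) (λ x → 𝟙 ⌊ x Fin.≟ a ⌋ * g (Fin.suc x))
    ≡⟨ ∑-allFin-≟ a (g ∘ Fin.suc) ⟩
  g (Fin.suc a)
    ∎
  where
  suc≟suc : ∀ x → 𝟙 ⌊ Fin.suc x Fin.≟ Fin.suc a ⌋ * g (Fin.suc x) ≡ 𝟙 ⌊ x Fin.≟ a ⌋ * g (Fin.suc x)
  suc≟suc x = cong (λ b → 𝟙 b * g (Fin.suc x)) (⌊⌋-map′ _ _ (x Fin.≟ a))

∑-allFin-≢ : ∀ {n} (a : Fin n) (g : Fin n → ℤ) →
  ∑ (filterᵇ (λ m → not ⌊ m Fin.≟ a ⌋) (allFin n)) g ≡ ∑ (allFin n) g - g a
∑-allFin-≢ {n} a g = begin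
  ∑ (filterᵇ (λ m → not ⌊ m Fin.≟ a ⌋) (allFin n)) g
    ≡⟨ ∑-filterᵇ _ (allFin n) g ⟩
  ∑ (allFin n) (λ m → 𝟙 (not ⌊ m Fin.≟ a ⌋) * g m)
    ≡⟨ ∑-cong (allFin n) (λ m → 𝟙-not ⌊ m Fin.≟ a ⌋ (g m)) ⟩
  ∑ (allFin n) (λ m → g m - 𝟙 ⌊ m Fin.≟ a ⌋ * g m)
    ≡⟨ ∑-distrib-- (allFin n) g _ ⟩
  ∑ (allFin n) g - ∑ (allFin n) (λ m → 𝟙 ⌊ m Fin.≟ a ⌋ * g m)
    ≡⟨ cong (λ t → ∑ (allFin n) g - t) (∑-allFin-≟ a g) ⟩
  ∑ (allFin n) g - g a
    ∎

∏ : ∀ {k} → Vec ℤ k → ℤ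
∏ = Vec.foldr′ _*_ 1ℤ

⨂ : ∀ {A : Set} {k} → Vec (A → ℤ) k → Vec A k → ℤ
⨂ []       []       = 1ℤ
⨂ (ψ ∷ ψs) (x ∷ xs) = ψ x * ⨂ ψs xs

∑-allVecs-⨂ : ∀ {A : Set} {k} (xs : List A) (ψs : Vec (A → ℤ) k) →
  ∑ (allVecs xs k) (⨂ ψs) ≡ ∏ (Vec.map (∑ xs) ψs)
∑-allVecs-⨂ xs []                 = refl
∑-allVecs-⨂ {k = suc k} xs (ψ ∷ ψs) = begin
  ∑ (concatMap (λ x → map (x ∷_) (allVecs xs k)) xs) (⨂ (ψ ∷ ψs))
    ≡⟨ ∑-concatMap _ xs _ ⟩
  ∑ xs (λ x → ∑ (map (x ∷_) (allVecs xs k)) (⨂ (ψ ∷ ψs)))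
    ≡⟨ ∑-cong xs (λ x → ∑-map (x ∷_) (allVecs xs k) _) ⟩
  ∑ xs (λ x → ∑ (allVecs xs k) (λ v → ψ x * ⨂ ψs v))
    ≡⟨ ∑-cong xs (λ x → sym (*-distribˡ-∑ (ψ x) (allVecs xs k) (⨂ ψs))) ⟩
  ∑ xs (λ x → ψ x * ∑ (allVecs xs k) (⨂ ψs))
    ≡⟨ sym (*-distribʳ-∑ _ xs ψ) ⟩
  ∑ xs ψ * ∑ (allVecs xs k) (⨂ ψs)
    ≡⟨ cong (∑ xs ψ *_) (∑-allVecs-⨂ xs ψs) ⟩
  ∑ xs ψ * ∏ (Vec.map (∑ xs) ψs)
    ∎

⨂-replicate-* : ∀ {A : Set} {k} (w : A → ℤ) (χs : Vec (A → ℤ) k) (xs : Vec A k) →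
  ⨂ (Vec.replicate k w) xs * ⨂ χs xs ≡ ⨂ (Vec.map (λ χ x → w x * χ x) χs) xs
⨂-replicate-* w []       []       = refl
⨂-replicate-* w (χ ∷ χs) (x ∷ xs) =
  trans (interchange (w x) _ (χ x) _) (cong (w x * χ x *_) (⨂-replicate-* w χs xs))
  where
  interchange : ∀ a b c d → (a * b) * (c * d) ≡ (a * c) * (b * d)
  interchange = solve-∀

-- The one-edge operator and its transpose

βᵀ : ∀ {n} → (Edge n → ℤ) → Edge n → ℤ
βᵀ {n} ψ (a , b) =
  if ⌊ a Fin.≟ b ⌋
  then - ∑ (filterᵇ (λ m → not ⌊ m Fin.≟ a ⌋) (allFin n)) (λ m → ψ (a , m))
  else ψ (a , b)

βᵀ-cong : ∀ {n} {ψ χ : Edge n → ℤ} → ψ ≗ χ → βᵀ ψ ≗ βᵀ χ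
βᵀ-cong {n} ψ≗χ (a , b) with ⌊ a Fin.≟ b ⌋
... | true  = cong -_ (∑-cong (filterᵇ (λ m → not ⌊ m Fin.≟ a ⌋) (allFin n)) (λ m → ψ≗χ (a , m)))
... | false = ψ≗χ (a , b)

βᵀ-*ˡ : ∀ {n} (c : ℤ) (ψ : Edge n → ℤ) → βᵀ (λ e → c * ψ e) ≗ λ e → c * βᵀ ψ e
βᵀ-*ˡ {n} c ψ (a , b) with ⌊ a Fin.≟ b ⌋
... | true  = trans (cong -_ (sym (*-distribˡ-∑ c (filterᵇ (λ m → not ⌊ m Fin.≟ a ⌋) (allFin n)) _)))
                    (ℤP.neg-distribʳ-* c _)
... | false = refl

βᵀ-*ʳ : ∀ {n} (c : ℤ) (ψ : Edge n → ℤ) → βᵀ (λ e → ψ e * c) ≗ λ e → βᵀ ψ e * c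
βᵀ-*ʳ c ψ e = trans (βᵀ-cong (λ e → ℤP.*-comm (ψ e) c) e) (trans (βᵀ-*ˡ c ψ e) (ℤP.*-comm c _))

Edges : ∀ n → List (Edge n)
Edges n = List.cartesianProduct (allFin n) (allFin n)

⟨_,_⟩ₑ : ∀ {n} → (Edge n → ℤ) → (Edge n → ℤ) → ℤ
⟨_,_⟩ₑ {n} w χ = ∑ (Edges n) (λ e → w e * χ e)

β : ∀ {n} → (Edge n → ℤ) → Edge n → ℤ
β w (a , b) = w (a , b) - w (a , a)

βᵀ-as-difference : ∀ {n} (ψ : Edge n → ℤ) a b →
  βᵀ ψ (a , b) ≡ ψ (a , b) - 𝟙 ⌊ b Fin.≟ a ⌋ * ∑ (allFin n) (λ m → ψ (a , m))
βᵀ-as-difference {n} ψ a b with a Fin.≟ b | b Fin.≟ a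
... | yes refl | yes _  = trans (cong -_ (∑-allFin-≢ a (λ m → ψ (a , m)))) (rearrange (ψ (a , a)) _)
  where
  rearrange : ∀ x S → - (S - x) ≡ x - 1ℤ * S
  rearrange = solve-∀
... | yes refl | no b≢a = ⊥-elim (b≢a refl)
... | no a≢b   | yes b≡a = ⊥-elim (a≢b (sym b≡a))
... | no _     | no _    = sym (cancel (ψ (a , b)) (∑ (allFin n) (λ m → ψ (a , m))))
  where
  cancel : ∀ x S → x - 0ℤ * S ≡ x
  cancel = solve-∀

βᵀ-adjoint : ∀ {n} (w χ : Edge n → ℤ) → ⟨ w , βᵀ χ ⟩ₑ ≡ ⟨ β w , χ ⟩ₑ
βᵀ-adjoint {n} w χ = begin
  ⟨ w , βᵀ χ ⟩ₑ
    ≡⟨ ∑-cartesianProduct (allFin n) (allFin n) (λ e → w e * βᵀ χ e) ⟩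
  ∑ (allFin n) (λ a → ∑ (allFin n) (λ b → w (a , b) * βᵀ χ (a , b)))
    ≡⟨ ∑-cong (allFin n) row ⟩
  ∑ (allFin n) (λ a → ∑ (allFin n) (λ b → β w (a , b) * χ (a , b)))
    ≡⟨ sym (∑-cartesianProduct (allFin n) (allFin n) (λ e → β w e * χ e)) ⟩
  ⟨ β w , χ ⟩ₑ
    ∎
  where
  row : ∀ a → ∑ (allFin n) (λ b → w (a , b) * βᵀ χ (a , b)) ≡ ∑ (allFin n) (λ b → β w (a , b) * χ (a , b))
  row a = begin
    ∑ (allFin n) (λ b → w (a , b) * βᵀ χ (a , b))
      ≡⟨ ∑-cong (allFin n) expand ⟩
    ∑ (allFin n) (λ b → w (a , b) * χ (a , b) - 𝟙 ⌊ b Fin.≟ a ⌋ * (w (a , b) * S))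
      ≡⟨ ∑-distrib-- (allFin n) _ _ ⟩
    wχ - ∑ (allFin n) (λ b → 𝟙 ⌊ b Fin.≟ a ⌋ * (w (a , b) * S))
      ≡⟨ cong (λ t → wχ - t) (∑-allFin-≟ a (λ b → w (a , b) * S)) ⟩
    wχ - w (a , a) * S
      ≡⟨ cong (λ t → wχ - t) (*-distribˡ-∑ (w (a , a)) (allFin n) (λ b → χ (a , b))) ⟩
    wχ - ∑ (allFin n) (λ b → w (a , a) * χ (a , b))
      ≡⟨ sym (∑-distrib-- (allFin n) _ _) ⟩
    ∑ (allFin n) (λ b → w (a , b) * χ (a , b) - w (a , a) * χ (a , b))
      ≡⟨ ∑-cong (allFin n) (λ b → factor (w (a , b)) (w (a , a)) (χ (a , b))) ⟩
    ∑ (allFin n) (λ b → β w (a , b) * χ (a , b))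
      ∎
    where
    S wχ : ℤ
    S  = ∑ (allFin n) (λ m → χ (a , m))
    wχ = ∑ (allFin n) (λ b → w (a , b) * χ (a , b))
    expand : ∀ b → w (a , b) * βᵀ χ (a , b) ≡ w (a , b) * χ (a , b) - 𝟙 ⌊ b Fin.≟ a ⌋ * (w (a , b) * S)
    expand b = trans (cong (w (a , b) *_) (βᵀ-as-difference χ a b))
                     (distribute (w (a , b)) (χ (a , b)) (𝟙 ⌊ b Fin.≟ a ⌋) S)
      where
      distribute : ∀ x y d S → x * (y - d * S) ≡ x * y - d * (x * S)
      distribute = solve-∀
    factor : ∀ x y z → x * z - y * z ≡ (x - y) * z
    factor = solve-∀

-- Transposes of B_i and Δ acting on functionals

⟨_∣_⟩ : ∀ {n k} → (Graph n k → ℤ) → Lin n k → ℤ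
⟨ φ ∣ v ⟩ = ∑ v (λ cG → proj₁ cG * φ (proj₂ cG))

⟨∣⟩-cong : ∀ {n k} {φ ψ : Graph n k → ℤ} → φ ≗ ψ → ∀ v → ⟨ φ ∣ v ⟩ ≡ ⟨ ψ ∣ v ⟩
⟨∣⟩-cong φ≗ψ v = ∑-cong v (λ cG → cong (proj₁ cG *_) (φ≗ψ (proj₂ cG)))

δ : ∀ {n k} → Graph n k → Graph n k → ℤ
δ H G = 𝟙 ⌊ G ≟G H ⌋

coeff≡⟨δ∣⟩ : ∀ {n k} (H : Graph n k) v → coeff H v ≡ ⟨ δ H ∣ v ⟩
coeff≡⟨δ∣⟩ H []            = refl
coeff≡⟨δ∣⟩ H ((c , G) ∷ v) = cong₂ _+_ select (coeff≡⟨δ∣⟩ H v)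
  where
  select : (if ⌊ G ≟G H ⌋ then c else 0ℤ) ≡ c * 𝟙 ⌊ G ≟G H ⌋
  select with ⌊ G ≟G H ⌋
  ... | true  = sym (ℤP.*-identityʳ c)
  ... | false = sym (ℤP.*-zeroʳ c)

Bᵀ : ∀ {n k} → Fin k → (Graph n k → ℤ) → Graph n k → ℤ
Bᵀ i φ G = βᵀ (λ e → φ (G [ i ]≔ e)) (lookup G i)

⟨∣Bop⟩ : ∀ {n k} (i : Fin k) (φ : Graph n k → ℤ) v → ⟨ φ ∣ Bop i v ⟩ ≡ ⟨ Bᵀ i φ ∣ v ⟩
⟨∣Bop⟩ i φ []                = refl
⟨∣Bop⟩ {n} {k} i φ ((c , G) ∷ v) =
  trans (∑-++ image (Bop i v) _) (cong₂ _+_ ⟨φ∣image⟩ (⟨∣Bop⟩ i φ v))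
  where
  a : Fin n
  a = proj₁ (lookup G i)
  others : List (Fin n)
  others = filterᵇ (λ m → not ⌊ m Fin.≟ a ⌋) (allFin n)
  image : Lin n k
  image = if ⌊ a Fin.≟ proj₂ (lookup G i) ⌋
          then map (λ m → (- c , G [ i ]≔ (a , m))) others
          else (c , G) ∷ []
  ⟨φ∣image⟩ : ⟨ φ ∣ image ⟩ ≡ c * Bᵀ i φ G
  ⟨φ∣image⟩ with ⌊ a Fin.≟ proj₂ (lookup G i) ⌋
  ... | true  = begin
    ∑ (map (λ m → (- c , G [ i ]≔ (a , m))) others) _  ≡⟨ ∑-map _ others _ ⟩
    ∑ others (λ m → - c * φ (G [ i ]≔ (a , m)))        ≡⟨ sym (*-distribˡ-∑ (- c) others _) ⟩
    - c * ∑ others (λ m → φ (G [ i ]≔ (a , m)))        ≡⟨ sym (ℤP.neg-distribˡ-* c _) ⟩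
    - (c * ∑ others (λ m → φ (G [ i ]≔ (a , m))))      ≡⟨ ℤP.neg-distribʳ-* c _ ⟩
    c * - ∑ others (λ m → φ (G [ i ]≔ (a , m)))        ∎
  ... | false = begin
    c * φ G + 0ℤ                  ≡⟨ ℤP.+-identityʳ _ ⟩
    c * φ G                       ≡⟨ cong (λ H → c * φ H) (sym (VecP.[]≔-lookup G i)) ⟩
    c * φ (G [ i ]≔ lookup G i)   ∎

Δᵀ : ∀ {n k} → (Graph n k → ℤ) → Graph n k → ℤ
Δᵀ {k = k} φ = foldl (λ ψ i → Bᵀ i ψ) φ (allFin k)

⟨∣Δ⟩ : ∀ {n k} (φ : Graph n k → ℤ) v → ⟨ φ ∣ Δ v ⟩ ≡ ⟨ Δᵀ φ ∣ v ⟩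
⟨∣Δ⟩ {k = k} φ v = ⟨∣foldr-Bop⟩ (allFin k) φ
  where
  ⟨∣foldr-Bop⟩ : ∀ is φ → ⟨ φ ∣ foldr Bop v is ⟩ ≡ ⟨ foldl (λ ψ i → Bᵀ i ψ) φ is ∣ v ⟩
  ⟨∣foldr-Bop⟩ []       φ = refl
  ⟨∣foldr-Bop⟩ (i ∷ is) φ = trans (⟨∣Bop⟩ i φ (foldr Bop v is)) (⟨∣foldr-Bop⟩ is (Bᵀ i φ))

Bᵀ-cong : ∀ {n k} (i : Fin k) {φ ψ : Graph n k → ℤ} → φ ≗ ψ → Bᵀ i φ ≗ Bᵀ i ψ
Bᵀ-cong i φ≗ψ G = βᵀ-cong (λ e → φ≗ψ (G [ i ]≔ e)) (lookup G i)

Bᵀ-⨂ : ∀ {n k} (i : Fin k) (ψs : Vec (Edge n → ℤ) k) → Bᵀ i (⨂ ψs) ≗ ⨂ (ψs [ i ]%= βᵀ)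
Bᵀ-⨂ Fin.zero    (ψ ∷ ψs) (e ∷ G) = βᵀ-*ʳ (⨂ ψs G) ψ e
Bᵀ-⨂ (Fin.suc i) (ψ ∷ ψs) (e ∷ G) =
  trans (βᵀ-*ˡ (ψ e) (λ e′ → ⨂ ψs (G [ i ]≔ e′)) (lookup G i)) (cong (ψ e *_) (Bᵀ-⨂ i ψs G))

foldl-updateAt-allFin : ∀ {A : Set} {k} (f : A → A) (xs : Vec A k) →
  foldl (λ ys i → ys [ i ]%= f) xs (allFin k) ≡ Vec.map f xs
foldl-updateAt-allFin f []       = refl
foldl-updateAt-allFin {A} {suc k} f (x ∷ xs) = begin
  foldl update (f x ∷ xs) (List.tabulate Fin.suc)
    ≡⟨ cong (foldl update (f x ∷ xs)) (sym (ListP.map-tabulate (λ i → i) Fin.suc)) ⟩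
  foldl update (f x ∷ xs) (map Fin.suc (allFin k))
    ≡⟨ foldl-update-suc (allFin k) xs ⟩
  f x ∷ foldl update xs (allFin k)
    ≡⟨ cong (f x ∷_) (foldl-updateAt-allFin f xs) ⟩
  f x ∷ Vec.map f xs
    ∎
  where
  update : ∀ {m} → Vec A m → Fin m → Vec A m
  update ys i = ys [ i ]%= f
  foldl-update-suc : ∀ is ys → foldl update (f x ∷ ys) (map Fin.suc is) ≡ f x ∷ foldl update ys is
  foldl-update-suc []       ys = refl
  foldl-update-suc (i ∷ is) ys = foldl-update-suc is (ys [ i ]%= f)

Δᵀ-⨂ : ∀ {n k} {φ : Graph n k → ℤ} (ψs : Vec (Edge n → ℤ) k) → φ ≗ ⨂ ψs → Δᵀ φ ≗ ⨂ (Vec.map βᵀ ψs)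
Δᵀ-⨂ {k = k} ψs φ≗⨂ψs G =
  trans (foldl-Bᵀ-⨂ (allFin k) ψs φ≗⨂ψs G) (cong (λ χs → ⨂ χs G) (foldl-updateAt-allFin βᵀ ψs))
  where
  foldl-Bᵀ-⨂ : ∀ is {φ} ψs → φ ≗ ⨂ ψs →
    foldl (λ ψ i → Bᵀ i ψ) φ is ≗ ⨂ (foldl (λ χs i → χs [ i ]%= βᵀ) ψs is)
  foldl-Bᵀ-⨂ []       ψs φ≗⨂ψs = φ≗⨂ψs
  foldl-Bᵀ-⨂ (i ∷ is) ψs φ≗⨂ψs =
    foldl-Bᵀ-⨂ is (ψs [ i ]%= βᵀ) (λ G → trans (Bᵀ-cong i φ≗⨂ψs G) (Bᵀ-⨂ i ψs G))

_≟ₑ_ : ∀ {n} → DecidableEquality (Edge n)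
_≟ₑ_ = ProdP.≡-dec Fin._≟_ Fin._≟_

δₑ : ∀ {n} → Edge n → Edge n → ℤ
δₑ h e = 𝟙 ⌊ e ≟ₑ h ⌋

δ-∷ : ∀ {n k} (h e : Edge n) (H G : Graph n k) → δ (h ∷ H) (e ∷ G) ≡ δₑ h e * δ H G
δ-∷ h e H G with e ≟ₑ h | G ≟G H
... | yes _ | yes _ = refl
... | yes _ | no _  = refl
... | no _  | yes _ = refl
... | no _  | no _  = refl

δ≗⨂δₑ : ∀ {n k} (H : Graph n k) → δ H ≗ ⨂ (Vec.map δₑ H)
δ≗⨂δₑ []      []      = refl
δ≗⨂δₑ (h ∷ H) (e ∷ G) = trans (δ-∷ h e H G) (cong (δₑ h e *_) (δ≗⨂δₑ H G))

-- Bernardi polynomials as sums of products of edge weights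

weight : ∀ {q n} → ℤ → ℤ → ℤ → Vec (Fin q) n → Edge n → ℤ
weight y z o f (a , b) =
  if ⌊ lookup f a Fin.<? lookup f b ⌋ then y
  else if ⌊ lookup f b Fin.<? lookup f a ⌋ then z
  else o

weight-loop : ∀ {q n} y z o (f : Vec (Fin q) n) a → weight y z o f (a , a) ≡ o
weight-loop y z o f a with lookup f a Fin.<? lookup f a
... | yes fa<fa = ⊥-elim (FinP.<-irrefl refl fa<fa)
... | no _      = refl

β-weight : ∀ {q n} y z o (f : Vec (Fin q) n) → β (weight y z o f) ≗ weight (y - o) (z - o) 0ℤ f
β-weight y z o f (a , b) rewrite weight-loop y z o f a
  with ⌊ lookup f a Fin.<? lookup f b ⌋ | ⌊ lookup f b Fin.<? lookup f a ⌋
... | true  | _     = refl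
... | false | true  = refl
... | false | false = ℤP.+-inverseʳ o

βᵀ-weight : ∀ {q n} y z o (f : Vec (Fin q) n) (χ : Edge n → ℤ) →
  ⟨ weight y z o f , βᵀ χ ⟩ₑ ≡ ⟨ weight (y - o) (z - o) 0ℤ f , χ ⟩ₑ
βᵀ-weight {n = n} y z o f χ =
  trans (βᵀ-adjoint (weight y z o f) χ) (∑-cong (Edges n) (λ e → cong (_* χ e) (β-weight y z o f e)))

#level : ∀ {n k q} → Vec (Fin q) n → Graph n k → ℕ
#level f = countᵇ (λ { (a , b) → not ⌊ lookup f a Fin.<? lookup f b ⌋ ∧ not ⌊ lookup f b Fin.<? lookup f a ⌋ })

#up+#down+#level≡k : ∀ {n k q} (f : Vec (Fin q) n) (G : Graph n k) → #up f G ℕ.+ #down f G ℕ.+ #level f G ≡ k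
#up+#down+#level≡k f [] = refl
#up+#down+#level≡k f ((a , b) ∷ G) with lookup f a Fin.<? lookup f b | lookup f b Fin.<? lookup f a
... | yes fa<fb | yes fb<fa = ⊥-elim (FinP.<-asym fa<fb fb<fa)
... | yes _     | no _      = cong suc (#up+#down+#level≡k f G)
... | no _      | yes _     =
  trans (cong (ℕ._+ #level f G) (ℕP.+-suc (#up f G) (#down f G))) (cong suc (#up+#down+#level≡k f G))
... | no _      | no _      =
  trans (ℕP.+-suc (#up f G ℕ.+ #down f G) (#level f G)) (cong suc (#up+#down+#level≡k f G))

monomial≡⨂weight : ∀ {n k q} y z o (f : Vec (Fin q) n) (G : Graph n k) →
  y ^ #up f G * z ^ #down f G * o ^ #level f G ≡ ⨂ (Vec.replicate k (weight y z o f)) G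
monomial≡⨂weight y z o f [] = refl
monomial≡⨂weight y z o f ((a , b) ∷ G) with lookup f a Fin.<? lookup f b | lookup f b Fin.<? lookup f a
... | yes fa<fb | yes fb<fa = ⊥-elim (FinP.<-asym fa<fb fb<fa)
... | yes _     | no _      =
  trans (ascending y (y ^ #up f G) (z ^ #down f G) (o ^ #level f G)) (cong (y *_) (monomial≡⨂weight y z o f G))
  where
  ascending : ∀ y Y Z O → y * Y * Z * O ≡ y * (Y * Z * O)
  ascending = solve-∀
... | no _      | yes _     =
  trans (descending z (y ^ #up f G) (z ^ #down f G) (o ^ #level f G)) (cong (z *_) (monomial≡⨂weight y z o f G))
  where
  descending : ∀ z Y Z O → Y * (z * Z) * O ≡ z * (Y * Z * O)
  descending = solve-∀
... | no _      | no _      =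
  trans (level o (y ^ #up f G) (z ^ #down f G) (o ^ #level f G)) (cong (o *_) (monomial≡⨂weight y z o f G))
  where
  level : ∀ o Y Z O → Y * Z * (o * O) ≡ o * (Y * Z * O)
  level = solve-∀

colourings : (q n : ℕ) → List (Vec (Fin q) n)
colourings q n = allVecs (allFin q) n

evalYZ-Bernardi : ∀ {n k} q y z (G : Graph n k) →
  evalYZ (Bernardi q G) y z ≡ ∑ (colourings q n) (λ f → ⨂ (Vec.replicate k (weight y z 1ℤ f)) G)
evalYZ-Bernardi {n} {k} q y z G = trans (∑-map _ (colourings q n) _) (∑-cong (colourings q n) term)
  where
  term : ∀ f → 1ℤ * y ^ #up f G * z ^ #down f G ≡ ⨂ (Vec.replicate k (weight y z 1ℤ f)) G
  term f = begin
    1ℤ * y ^ #up f G * z ^ #down f G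
      ≡⟨ drop-1 (y ^ #up f G) (z ^ #down f G) ⟩
    y ^ #up f G * z ^ #down f G * 1ℤ
      ≡⟨ cong (y ^ #up f G * z ^ #down f G *_) (sym (ℤP.^-zeroˡ (#level f G))) ⟩
    y ^ #up f G * z ^ #down f G * 1ℤ ^ #level f G
      ≡⟨ monomial≡⨂weight y z 1ℤ f G ⟩
    ⨂ (Vec.replicate k (weight y z 1ℤ f)) G
      ∎
    where
    drop-1 : ∀ Y Z → 1ℤ * Y * Z ≡ Y * Z * 1ℤ
    drop-1 = solve-∀

evalYZ-trunc-Bernardi : ∀ {n k} q y z (G : Graph n k) →
  evalYZ (trunc k (Bernardi q G)) y z ≡ ∑ (colourings q n) (λ f → ⨂ (Vec.replicate k (weight y z 0ℤ f)) G)
evalYZ-trunc-Bernardi {n} {k} q y z G =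
  trans (∑-filterᵇ _ (Bernardi q G) _) (trans (∑-map _ (colourings q n) _) (∑-cong (colourings q n) term))
  where
  term : ∀ f → 𝟙 ⌊ #up f G ℕ.+ #down f G ℕ.≟ k ⌋ * (1ℤ * y ^ #up f G * z ^ #down f G)
             ≡ ⨂ (Vec.replicate k (weight y z 0ℤ f)) G
  term f = begin
    𝟙 ⌊ u+d ℕ.≟ k ⌋ * (1ℤ * y ^ #up f G * z ^ #down f G)
      ≡⟨ cong (λ m → 𝟙 ⌊ u+d ℕ.≟ m ⌋ * (1ℤ * y ^ #up f G * z ^ #down f G)) (sym (#up+#down+#level≡k f G)) ⟩
    𝟙 ⌊ u+d ℕ.≟ u+d ℕ.+ #level f G ⌋ * (1ℤ * y ^ #up f G * z ^ #down f G)
      ≡⟨ cong (_* (1ℤ * y ^ #up f G * z ^ #down f G)) (𝟙[m≟m+l]≡0^l u+d (#level f G)) ⟩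
    0ℤ ^ #level f G * (1ℤ * y ^ #up f G * z ^ #down f G)
      ≡⟨ reorder (0ℤ ^ #level f G) (y ^ #up f G) (z ^ #down f G) ⟩
    y ^ #up f G * z ^ #down f G * 0ℤ ^ #level f G
      ≡⟨ monomial≡⨂weight y z 0ℤ f G ⟩
    ⨂ (Vec.replicate k (weight y z 0ℤ f)) G
      ∎
    where
    u+d : ℕ
    u+d = #up f G ℕ.+ #down f G
    reorder : ∀ O Y Z → O * (1ℤ * Y * Z) ≡ Y * Z * O
    reorder = solve-∀

weightedSum : ∀ {F : Set} n k → List F → (F → Edge n → ℤ) → Lin n k
weightedSum n k Fs W = map (λ G → (∑ Fs (λ f → ⨂ (Vec.replicate k (W f)) G) , G)) (allGraphs n k)

⟨⨂∣weightedSum⟩ : ∀ {F : Set} {n k} (Fs : List F) (W : F → Edge n → ℤ) (χs : Vec (Edge n → ℤ) k) →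
  ⟨ ⨂ χs ∣ weightedSum n k Fs W ⟩ ≡ ∑ Fs (λ f → ∏ (Vec.map ⟨ W f ,_⟩ₑ χs))
⟨⨂∣weightedSum⟩ {n = n} {k} Fs W χs = begin
  ⟨ ⨂ χs ∣ weightedSum n k Fs W ⟩
    ≡⟨ ∑-map _ (allGraphs n k) _ ⟩
  ∑ (allGraphs n k) (λ G → ∑ Fs (λ f → ⨂ (Vec.replicate k (W f)) G) * ⨂ χs G)
    ≡⟨ ∑-cong (allGraphs n k) (λ G → *-distribʳ-∑ (⨂ χs G) Fs _) ⟩
  ∑ (allGraphs n k) (λ G → ∑ Fs (λ f → ⨂ (Vec.replicate k (W f)) G * ⨂ χs G))
    ≡⟨ ∑-comm (allGraphs n k) Fs _ ⟩
  ∑ Fs (λ f → ∑ (allGraphs n k) (λ G → ⨂ (Vec.replicate k (W f)) G * ⨂ χs G))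
    ≡⟨ ∑-cong Fs (λ f → ∑-cong (allGraphs n k) (⨂-replicate-* (W f) χs)) ⟩
  ∑ Fs (λ f → ∑ (allGraphs n k) (⨂ (Vec.map (λ χ e → W f e * χ e) χs)))
    ≡⟨ ∑-cong Fs (λ f → ∑-allVecs-⨂ (Edges n) (Vec.map (λ χ e → W f e * χ e) χs)) ⟩
  ∑ Fs (λ f → ∏ (Vec.map (∑ (Edges n)) (Vec.map (λ χ e → W f e * χ e) χs)))
    ≡⟨ ∑-cong Fs (λ f → cong ∏ (sym (VecP.map-∘ _ _ χs))) ⟩
  ∑ Fs (λ f → ∏ (Vec.map ⟨ W f ,_⟩ₑ χs))
    ∎

𝓑≡weightedSum : ∀ n k q y z → 𝓑 n k q y z ≡ weightedSum n k (colourings q n) (weight y z 1ℤ)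
𝓑≡weightedSum n k q y z = ListP.map-cong (λ G → cong (_, G) (evalYZ-Bernardi q y z G)) (allGraphs n k)

𝓑^≡weightedSum : ∀ n k q y z → 𝓑^ n k q y z ≡ weightedSum n k (colourings q n) (weight y z 0ℤ)
𝓑^≡weightedSum n k q y z = ListP.map-cong (λ G → cong (_, G) (evalYZ-trunc-Bernardi q y z G)) (allGraphs n k)

-- The identity holds for n = 0 as well.
theorem1p1 : (n k : ℕ) → 1 ≤ n → (q : ℕ) → (y z : ℤ) → (H : Graph n k) →
    coeff H (Δ (𝓑 n k q y z)) ≡ coeff H (𝓑^ n k q (y - 1ℤ) (z - 1ℤ))
theorem1p1 n k _ q y z H = begin
  coeff H (Δ (𝓑 n k q y z))
    ≡⟨ coeff≡⟨δ∣⟩ H (Δ (𝓑 n k q y z)) ⟩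
  ⟨ δ H ∣ Δ (𝓑 n k q y z) ⟩
    ≡⟨ ⟨∣Δ⟩ (δ H) (𝓑 n k q y z) ⟩
  ⟨ Δᵀ (δ H) ∣ 𝓑 n k q y z ⟩
    ≡⟨ ⟨∣⟩-cong (Δᵀ-⨂ δs (δ≗⨂δₑ H)) (𝓑 n k q y z) ⟩
  ⟨ ⨂ (Vec.map βᵀ δs) ∣ 𝓑 n k q y z ⟩
    ≡⟨ cong ⟨ ⨂ (Vec.map βᵀ δs) ∣_⟩ (𝓑≡weightedSum n k q y z) ⟩
  ⟨ ⨂ (Vec.map βᵀ δs) ∣ weightedSum n k Fs (weight y z 1ℤ) ⟩
    ≡⟨ ⟨⨂∣weightedSum⟩ Fs _ (Vec.map βᵀ δs) ⟩
  ∑ Fs (λ f → ∏ (Vec.map ⟨ weight y z 1ℤ f ,_⟩ₑ (Vec.map βᵀ δs)))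
    ≡⟨ ∑-cong Fs (cong ∏ ∘ edgewise) ⟩
  ∑ Fs (λ f → ∏ (Vec.map ⟨ weight y′ z′ 0ℤ f ,_⟩ₑ δs))
    ≡⟨ sym (⟨⨂∣weightedSum⟩ Fs _ δs) ⟩
  ⟨ ⨂ δs ∣ weightedSum n k Fs (weight y′ z′ 0ℤ) ⟩
    ≡⟨ cong ⟨ ⨂ δs ∣_⟩ (sym (𝓑^≡weightedSum n k q y′ z′)) ⟩
  ⟨ ⨂ δs ∣ 𝓑^ n k q y′ z′ ⟩
    ≡⟨ sym (⟨∣⟩-cong (δ≗⨂δₑ H) (𝓑^ n k q y′ z′)) ⟩
  ⟨ δ H ∣ 𝓑^ n k q y′ z′ ⟩
    ≡⟨ sym (coeff≡⟨δ∣⟩ H (𝓑^ n k q y′ z′)) ⟩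
  coeff H (𝓑^ n k q y′ z′)
    ∎
  where
  y′ z′ : ℤ
  y′ = y - 1ℤ
  z′ = z - 1ℤ
  δs : Vec (Edge n → ℤ) k
  δs = Vec.map δₑ H
  Fs : List (Vec (Fin q) n)
  Fs = colourings q n
  edgewise : ∀ f → Vec.map ⟨ weight y z 1ℤ f ,_⟩ₑ (Vec.map βᵀ δs) ≡ Vec.map ⟨ weight y′ z′ 0ℤ f ,_⟩ₑ δs
  edgewise f = trans (sym (VecP.map-∘ _ βᵀ δs)) (VecP.map-cong (βᵀ-weight y z 1ℤ f) δs)
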